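{- Let $w$ be a computation with $[w]=1$ whose contexts are all irreducible, and let $\pi$ be a reduction of $w$. For any two contexts $w_i$ and $w_j$ of $w$, there is at most one block in $w_i$ that is $R_\pi$-related to a block in $w_j$.
   Context: Let $G=(V,I)$ be an undirected graph ($I$ symmetric, self-loops allowed); $\mathrm{Ops}=\{o^+,o^-\mid o\in V\}$; $\cong$ the smallest congruence on $\mathrm{Ops}^*$ with $o_1^{\pm}o_2^{\pm}\cong o_2^{\pm}o_1^{\pm}$ for $o_1\,I\,o_2$ and $o^+o^-\cong\varepsilon$; $[w]$ the class of $w$, $1=[\varepsilon]$. A set of symbols is dependent if it contains no two distinct independent symbols; a word is dependent if its set of symbols is. Context decomposition of $w\in\mathrm{Ops}^+$: if $w$ is dependent it is one context; else the first context is the maximal dependent prefix, followed by the context decomposition of the rest. A word is irreducible if it cannot be written as $w'\,a\,w_I\,b\,w''$ with either ($a=o^+$, $b=o^-$, and $o$ commutes with every symbol occurring in $w_I$) or ($a=o^-$, $b=o^+$, $o\,I\,o$, and $o$ commutes with every symbol occurring in $w_I$). A reduction of a word is a finite sequence of applications of the rules (R1) delete an adjacent factor $o^+o^-$; (R2) delete an adjacent factor $o^-o^+$ if $o\,I\,o$; (R3) swap adjacent letters $a\in\{o_1^\pm\}$, $b\in\{o_2^\pm\}$ if $o_1\,I\,o_2$, $o_1\ne o_2$; transforming it into $\varepsilon$. Letters of $w$ are annotated by their positions. For $\pi$: letters $x\,R_\pi\,y$ if $\pi$ deletes them together in one application of (R1) or (R2); inductively for infixes of contexts, $t_1s_1\,R_\pi\,s_2t_2$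 if there are contexts $w_i=w_{i1}t_1s_1w_{i2}$, $w_j=w_{j1}s_2t_2w_{j2}$ with $s_1\,R_\pi\,s_2$ and $t_1\,R_\pi\,t_2$. A cluster is an infix $u$ of a context $w_i$ with $u\,R_\pi\,u'$ for some infix $u'$ of some context $w_j$; a block is a maximal cluster of $w_i$. -}

module Defs where

open import Data.Nat using (ℕ; _+_; _≤_; _<_)
open import Data.Fin using (Fin; toℕ)
open import Data.List using (List; []; _∷_; _++_; map; length; lookup; take; allFin)
open import Data.Nat.ListAction using (sum)
open import Data.List.Membership.Propositional using (_∈_)
open import Data.Product using (Σ; ∃; _×_; _,_; proj₁)
open import Data.Sum using (_⊎_)
open import Relation.Binary.PropositionalEquality using (_≡_; _≢_)
open import Relation.Nullary using (¬_)

-- An undirected graph G = (V, I): I symmetric, self-loops allowed.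
record Graph : Set₁ where
  field
    V     : Set
    I     : V → V → Set
    I-sym : ∀ {a b} → I a b → I b a

data Sign : Set where
  plus minus : Sign

module _ (G : Graph) where
  open Graph G

  -- o⁺ is (o , plus), o⁻ is (o , minus)
  Op : Set
  Op = V × Sign

  Word : Set
  Word = List Op

  sym : Op → V
  sym = proj₁

  symbols : Word → List V
  symbols w = map sym w

  infix 4 _≅_
  data _≅_ : Word → Word → Set where
    ≅-refl   : ∀ {u} → u ≅ u
    ≅-sym    : ∀ {u v} → u ≅ v → v ≅ u
    ≅-trans  : ∀ {u v x} → u ≅ v → v ≅ x → u ≅ x
    ≅-comm   : ∀ u v o₁ s₁ o₂ s₂ → I o₁ o₂ →
               (u ++ (o₁ , s₁) ∷ (o₂ , s₂) ∷ v) ≅ (u ++ (o₂ , s₂) ∷ (o₁ , s₁) ∷ v)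
    ≅-cancel : ∀ u v o → (u ++ (o , plus) ∷ (o , minus) ∷ v) ≅ (u ++ v)

  Dependent : Word → Set
  Dependent w = ∀ {x y} → x ∈ symbols w → y ∈ symbols w → x ≢ y → ¬ I x y

  MaxDepPrefix : Word → Word → Set
  MaxDepPrefix p w =
    (∃ λ r → w ≡ p ++ r) × Dependent p ×
    (∀ q r → w ≡ q ++ r → length p < length q → ¬ Dependent q)

  data Decomp : Word → List Word → Set where
    one  : ∀ {w} → w ≢ [] → Dependent w → Decomp w (w ∷ [])
    more : ∀ {p r cs} → ¬ Dependent (p ++ r) → MaxDepPrefix p (p ++ r) →
           Decomp r cs → Decomp (p ++ r) (p ∷ cs)

  CommutesWith : V → Word → Set
  CommutesWith o u = ∀ {x} → x ∈ symbols u → I o x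

  Irreducible : Word → Set
  Irreducible w =
    ¬ (Σ Word λ w' → Σ Op λ a → Σ Word λ wI → Σ Op λ b → Σ Word λ w'' →
        (w ≡ w' ++ a ∷ wI ++ b ∷ w'') ×
        ((Σ V λ o → a ≡ (o , plus) × b ≡ (o , minus) × CommutesWith o wI) ⊎
         (Σ V λ o → a ≡ (o , minus) × b ≡ (o , plus) × I o o × CommutesWith o wI)))

  -- Reductions act on the word with letters annotated by their positions:
  -- the current word is represented by the list of (original) positions of its letters.
  -- Red w s : a reduction sequence transforming the annotated word s into ε.
  data Red (w : Word) : List (Fin (length w)) → Set where
    done : Red w []
    r1   : ∀ xs ys p q o → lookup w p ≡ (o , plus) → lookup w q ≡ (o , minus) →
           Red w (xs ++ ys) → Red w (xs ++ p ∷ q ∷ ys)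
    r2   : ∀ xs ys p q o → lookup w p ≡ (o , minus) → lookup w q ≡ (o , plus) → I o o →
           Red w (xs ++ ys) → Red w (xs ++ p ∷ q ∷ ys)
    r3   : ∀ xs ys p q → I (sym (lookup w p)) (sym (lookup w q)) →
           sym (lookup w p) ≢ sym (lookup w q) →
           Red w (xs ++ q ∷ p ∷ ys) → Red w (xs ++ p ∷ q ∷ ys)

  Reduction : Word → Set
  Reduction w = Red w (allFin (length w))

  data DelTogether {w : Word} : ∀ {s} → Red w s → Fin (length w) → Fin (length w) → Set where
    here1  : ∀ {xs ys p q o e₁ e₂ ρ} → DelTogether (r1 xs ys p q o e₁ e₂ ρ) p q
    here2  : ∀ {xs ys p q o e₁ e₂ i ρ} → DelTogether (r2 xs ys p q o e₁ e₂ i ρ) p q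
    later1 : ∀ {xs ys p q o e₁ e₂ ρ x y} → DelTogether ρ x y →
             DelTogether (r1 xs ys p q o e₁ e₂ ρ) x y
    later2 : ∀ {xs ys p q o e₁ e₂ i ρ x y} → DelTogether ρ x y →
             DelTogether (r2 xs ys p q o e₁ e₂ i ρ) x y
    later3 : ∀ {xs ys p q i d ρ x y} → DelTogether ρ x y →
             DelTogether (r3 xs ys p q i d ρ) x y

  -- An infix of w is given by (start position , length).
  Infix : Set
  Infix = ℕ × ℕ

  ctxStart : (cs : List Word) → Fin (length cs) → ℕ
  ctxStart cs i = sum (map length (take (toℕ i) cs))

  InCtx : (cs : List Word) → Fin (length cs) → Infix → Set
  InCtx cs i (a , ℓ) =
    1 ≤ ℓ × ctxStart cs i ≤ a × a + ℓ ≤ ctxStart cs i + length (lookup cs i)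

  data Rπ {w : Word} (cs : List Word) (π : Reduction w) : Infix → Infix → Set where
    base : ∀ {x y} → DelTogether π x y → Rπ cs π (toℕ x , 1) (toℕ y , 1)
    base' : ∀ {x y} → DelTogether π x y → Rπ cs π (toℕ y , 1) (toℕ x , 1)
    -- t₁ = (a , k), s₁ = (a + k , m), s₂ = (b , m'), t₂ = (b + m' , k')
    step : ∀ {a k m b m' k'} →
           Rπ cs π (a + k , m) (b , m') →
           Rπ cs π (a , k) (b + m' , k') →
           (∃ λ i → InCtx cs i (a , k + m)) →
           (∃ λ j → InCtx cs j (b , m' + k')) →
           Rπ cs π (a , k + m) (b , m' + k')

  _⊑_ : Infix → Infix → Set
  (a , ℓ) ⊑ (b , m) = b ≤ a × a + ℓ ≤ b + m

  Cluster : {w : Word} (cs : List Word) (π : Reduction w) → Fin (length cs) → Infix → Set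
  Cluster cs π i u =
    InCtx cs i u × (Σ (Fin (length cs)) λ j → Σ Infix λ u' → InCtx cs j u' × Rπ cs π u u')

  Block : {w : Word} (cs : List Word) (π : Reduction w) → Fin (length cs) → Infix → Set
  Block cs π i u = Cluster cs π i u × (∀ v → Cluster cs π i v → u ⊑ v → u ≡ v)

-- A reduction deletes the letters of w in pairs.  This matching of positions is symmetric
-- and functional, never pairs two letters of one context (for adjacent letters this would
-- contradict irreducibility), and is nested: a letter strictly between two matched letters
-- and dependent on them is matched strictly between them as well.  These properties are
-- collected in a MatchingStructure over an arbitrary strict total order.  There, two pairs
-- matched from context i to context j force the letter right after the start of the first
-- pair to be matched with the letter right before its end (TwoPairs.next-partner); the
-- reversed order gives the mirror image for free.  R_π-related infixes have matched ends,
-- so if two blocks of w_i related to infixes of w_j crossed, next-partner would extend one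
-- of them by a letter, against maximality; two blocks that do not cross are nested, hence
-- equal by maximality.
module Submission where

open import Defs
open import Data.Nat using (ℕ; zero; suc; _+_; _∸_; _≤_; _<_; z≤n; s≤s)
import Data.Nat.Properties as ℕₚ
open import Data.Fin using (Fin; toℕ; fromℕ<) renaming (zero to fzero; suc to fsuc)
import Data.Fin.Properties as Finₚ
open import Data.List using (List; []; _∷_; _++_; length; lookup; allFin; tabulate; concat; take; drop; map)
open import Data.List.Properties using (length-++; ++-assoc; ++-identityʳ)
open import Data.Nat.ListAction using (sum)
open import Data.List.Membership.Propositional using (_∈_; _∉_)
open import Data.List.Membership.Propositional.Properties using (∈-map⁺; ∈-lookup; ∈-tabulate⁺; ∈-tabulate⁻; ∈-allFin)
open import Data.List.Relation.Unary.Any using (here; there)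
open import Data.List.Relation.Unary.All as All using (All; []; _∷_)
open import Data.List.Relation.Unary.AllPairs using ([]; _∷_)
import Data.List.Relation.Unary.Unique.Propositional as UniqueProp
open import Data.List.Relation.Unary.Unique.Propositional.Properties using (allFin⁺)
import Data.List.Relation.Binary.Subset.Propositional as SubsetProp
import Data.List.Relation.Binary.Disjoint.Propositional as DisjointProp
open import Data.Product using (Σ; ∃; ∃₂; _×_; _,_; proj₁; proj₂)
open import Data.Sum using (_⊎_; inj₁; inj₂) renaming (map to ⊎-map)
open import Data.Empty using (⊥; ⊥-elim)
open import Function using (_∘_; id; flip)
open import Relation.Nullary using (¬_; yes; no)
open import Relation.Binary.Definitions using (DecidableEquality; Transitive; Trichotomous; Tri; tri<; tri≈; tri>)
open import Relation.Binary.PropositionalEquality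
  using (_≡_; _≢_; refl; cong; cong₂; subst; subst₂; trans; ≢-sym; module ≡-Reasoning)
  renaming (sym to ≡-sym)

module ListOrder {A : Set} where
  open UniqueProp {A = A} using (Unique)
  open SubsetProp {A = A} using (_⊆_)
  open DisjointProp {A = A} using (Disjoint)

  private variable
    a b c p q p₀ q₀ : A
    s ys : List A

  data Bef : List A → A → A → Set where
    bef-here  : ∀ {a b s} → b ∈ s → Bef (a ∷ s) a b
    bef-there : ∀ {a b c s} → Bef s a b → Bef (c ∷ s) a b

  Between : List A → A → A → A → Set
  Between s p q c = Bef s p c × Bef s c q

  ⊆-insert : (xs : List A) → xs ++ ys ⊆ xs ++ p ∷ q ∷ ys
  ⊆-insert []       m         = there (there m)
  ⊆-insert (x ∷ xs) (here e)  = here e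
  ⊆-insert (x ∷ xs) (there m) = there (⊆-insert xs m)

  ⊆-swap : (xs : List A) → xs ++ q ∷ p ∷ ys ⊆ xs ++ p ∷ q ∷ ys
  ⊆-swap []       (here e)          = there (here e)
  ⊆-swap []       (there (here e))  = here e
  ⊆-swap []       (there (there m)) = there (there m)
  ⊆-swap (x ∷ xs) (here e)          = here e
  ⊆-swap (x ∷ xs) (there m)         = there (⊆-swap xs m)

  ⊆-middle : (xs : List A) → p ∷ q ∷ [] ⊆ xs ++ p ∷ q ∷ ys
  ⊆-middle []       (here e)         = here e
  ⊆-middle []       (there (here e)) = there (here e)
  ⊆-middle (x ∷ xs) m                = there (⊆-middle xs m)

  ∈-delete : (xs : List A) → b ∈ xs ++ p ∷ q ∷ ys → b ∉ p ∷ q ∷ [] → b ∈ xs ++ ys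
  ∈-delete []       (here e)          b∉ = ⊥-elim (b∉ (here e))
  ∈-delete []       (there (here e))  b∉ = ⊥-elim (b∉ (there (here e)))
  ∈-delete []       (there (there m)) b∉ = m
  ∈-delete (x ∷ xs) (here e)          b∉ = here e
  ∈-delete (x ∷ xs) (there m)         b∉ = there (∈-delete xs m b∉)

  unique-delete : (xs : List A) → Unique (xs ++ p ∷ q ∷ ys) → Unique (xs ++ ys)
  unique-delete []       (_ ∷ _ ∷ u) = u
  unique-delete (x ∷ xs) (x∉ ∷ u)    = All.tabulate (All.lookup x∉ ∘ ⊆-insert xs) ∷ unique-delete xs u

  unique-swap : (xs : List A) → Unique (xs ++ p ∷ q ∷ ys) → Unique (xs ++ q ∷ p ∷ ys)
  unique-swap []       ((p≢q ∷ p∉) ∷ q∉ ∷ u) = (≢-sym p≢q ∷ q∉) ∷ p∉ ∷ u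
  unique-swap (x ∷ xs) (x∉ ∷ u)              = All.tabulate (All.lookup x∉ ∘ ⊆-swap xs) ∷ unique-swap xs u

  unique-middle : (xs : List A) → Unique (xs ++ p ∷ q ∷ ys) → Disjoint (p ∷ q ∷ []) (xs ++ ys)
  unique-middle []       ((_ ∷ p∉) ∷ _) (here refl , m)         = All.lookup p∉ m refl
  unique-middle []       (_ ∷ q∉ ∷ _)   (there (here refl) , m) = All.lookup q∉ m refl
  unique-middle (x ∷ xs) (x∉ ∷ _)       (v∈ , here refl)        = All.lookup x∉ (⊆-middle xs v∈) refl
  unique-middle (x ∷ xs) (_ ∷ u)        (v∈ , there m)          = unique-middle xs u (v∈ , m)

  bef-∈₁ : Bef s a b → a ∈ s
  bef-∈₁ (bef-here _)  = here refl
  bef-∈₁ (bef-there B) = there (bef-∈₁ B)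

  bef-∈₂ : Bef s a b → b ∈ s
  bef-∈₂ (bef-here m)  = there m
  bef-∈₂ (bef-there B) = there (bef-∈₂ B)

  bef-irrefl : Unique s → ¬ Bef s a a
  bef-irrefl (a∉ ∷ _) (bef-here m)  = All.lookup a∉ m refl
  bef-irrefl (_ ∷ u)  (bef-there B) = bef-irrefl u B

  bef-trans : Unique s → Bef s a b → Bef s b c → Bef s a c
  bef-trans (x∉ ∷ _) (bef-here m)  (bef-here _)   = ⊥-elim (All.lookup x∉ m refl)
  bef-trans _        (bef-here _)  (bef-there B)  = bef-here (bef-∈₂ B)
  bef-trans (x∉ ∷ _) (bef-there B) (bef-here _)   = ⊥-elim (All.lookup x∉ (bef-∈₂ B) refl)
  bef-trans (_ ∷ u)  (bef-there B) (bef-there B') = bef-there (bef-trans u B B')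

  bef-adjacent : (xs : List A) → Bef (xs ++ p ∷ q ∷ ys) p q
  bef-adjacent []       = bef-here (here refl)
  bef-adjacent (x ∷ xs) = bef-there (bef-adjacent xs)

  bef-insert : (xs : List A) → Bef (xs ++ ys) a b → Bef (xs ++ p ∷ q ∷ ys) a b
  bef-insert []       B             = bef-there (bef-there B)
  bef-insert (x ∷ xs) (bef-here m)  = bef-here (⊆-insert xs m)
  bef-insert (x ∷ xs) (bef-there B) = bef-there (bef-insert xs B)

  bef-delete : (xs : List A) → Bef (xs ++ p ∷ q ∷ ys) a b →
               a ∉ p ∷ q ∷ [] → b ∉ p ∷ q ∷ [] → Bef (xs ++ ys) a b
  bef-delete []       (bef-here _)              a∉ _  = ⊥-elim (a∉ (here refl))
  bef-delete []       (bef-there (bef-here _))  a∉ _  = ⊥-elim (a∉ (there (here refl)))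
  bef-delete []       (bef-there (bef-there B)) _  _  = B
  bef-delete (x ∷ xs) (bef-here m)              _  b∉ = bef-here (∈-delete xs m b∉)
  bef-delete (x ∷ xs) (bef-there B)             a∉ b∉ = bef-there (bef-delete xs B a∉ b∉)

  bef-swap : (xs : List A) → Bef (xs ++ q ∷ p ∷ ys) a b → ¬ (a ≡ q × b ≡ p) →
             Bef (xs ++ p ∷ q ∷ ys) a b
  bef-swap []       (bef-here (here e))       ¬qp = ⊥-elim (¬qp (refl , e))
  bef-swap []       (bef-here (there m))      _   = bef-there (bef-here m)
  bef-swap []       (bef-there (bef-here m))  _   = bef-here (there m)
  bef-swap []       (bef-there (bef-there B)) _   = bef-there (bef-there B)
  bef-swap (x ∷ xs) (bef-here m)              _   = bef-here (⊆-swap xs m)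
  bef-swap (x ∷ xs) (bef-there B)             ¬qp = bef-there (bef-swap xs B ¬qp)

  after-adjacent : (xs : List A) → Unique (xs ++ p ∷ q ∷ ys) → Bef (xs ++ p ∷ q ∷ ys) p c →
                   c ≡ q ⊎ Bef (xs ++ p ∷ q ∷ ys) q c
  after-adjacent []       _        (bef-here (here e))  = inj₁ e
  after-adjacent []       _        (bef-here (there m)) = inj₂ (bef-there (bef-here m))
  after-adjacent []       (p∉ ∷ _) (bef-there B)        = ⊥-elim (All.lookup p∉ (bef-∈₁ B) refl)
  after-adjacent (x ∷ xs) (x∉ ∷ _) (bef-here _)         = ⊥-elim (All.lookup x∉ (⊆-middle xs (here refl)) refl)
  after-adjacent (x ∷ xs) (_ ∷ u)  (bef-there B)        with after-adjacent xs u B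
  ... | inj₁ e  = inj₁ e
  ... | inj₂ B' = inj₂ (bef-there B')

  before-adjacent : (xs : List A) → Unique (xs ++ p ∷ q ∷ ys) → Bef (xs ++ p ∷ q ∷ ys) c q →
                    c ≡ p ⊎ Bef (xs ++ p ∷ q ∷ ys) c p
  before-adjacent []       _            (bef-here _)              = inj₁ refl
  before-adjacent []       (_ ∷ q∉ ∷ _) (bef-there (bef-here m))  = ⊥-elim (All.lookup q∉ m refl)
  before-adjacent []       (_ ∷ q∉ ∷ _) (bef-there (bef-there B)) = ⊥-elim (All.lookup q∉ (bef-∈₂ B) refl)
  before-adjacent (x ∷ xs) _            (bef-here _)              = inj₂ (bef-here (⊆-middle xs (here refl)))
  before-adjacent (x ∷ xs) (_ ∷ u)      (bef-there B)             with before-adjacent xs u B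
  ... | inj₁ e  = inj₁ e
  ... | inj₂ B' = inj₂ (bef-there B')

  nothing-between-adjacent : (xs : List A) → Unique (xs ++ p ∷ q ∷ ys) →
                             ¬ Between (xs ++ p ∷ q ∷ ys) p q c
  nothing-between-adjacent xs u (pc , cq) with after-adjacent xs u pc
  ... | inj₁ refl = bef-irrefl u cq
  ... | inj₂ qc   = bef-irrefl u (bef-trans u qc cq)

  -- Here P' relates letters of the shorter word and P extends
  -- it by the deleted pair; this is the shape of a partner relation of a reduction.
  between-across-deletion :
    DecidableEquality A → (xs : List A) → {P P' : A → A → Set} →
    Unique (xs ++ p₀ ∷ q₀ ∷ ys) → P p₀ q₀ → P q₀ p₀ → (∀ {x y} → P' x y → P x y) →
    p ∈ xs ++ ys → q ∈ xs ++ ys →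
    (Between (xs ++ ys) p q c → ∃ λ c' → P' c c' × Between (xs ++ ys) p q c') →
    Between (xs ++ p₀ ∷ q₀ ∷ ys) p q c → ∃ λ c' → P c c' × Between (xs ++ p₀ ∷ q₀ ∷ ys) p q c'
  between-across-deletion {p₀ = p₀} {q₀ = q₀} {ys = ys} {c = c} _≟_ xs u P₀ P₀' lift p∈ q∈ ih (pc , cq)
    with c ≟ p₀ | c ≟ q₀
  ... | yes refl | _ with after-adjacent xs u cq
  ...   | inj₁ refl = ⊥-elim (unique-middle xs u (there (here refl) , q∈))
  ...   | inj₂ q₀q  = q₀ , P₀ , bef-trans u pc (bef-adjacent xs) , q₀q
  between-across-deletion {p₀ = p₀} _≟_ xs u P₀ P₀' lift p∈ q∈ ih (pc , cq)
      | no _ | yes refl with before-adjacent xs u pc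
  ...   | inj₁ refl = ⊥-elim (unique-middle xs u (here refl , p∈))
  ...   | inj₂ pp₀  = p₀ , P₀' , pp₀ , bef-trans u (bef-adjacent xs) cq
  between-across-deletion {p₀ = p₀} {q₀ = q₀} {ys = ys} {c = c} _≟_ xs u P₀ P₀' lift p∈ q∈ ih (pc , cq)
      | no c≢p₀ | no c≢q₀
    with ih (bef-delete xs pc (outside p∈) c∉ , bef-delete xs cq c∉ (outside q∈))
    where
    outside : ∀ {x} → x ∈ xs ++ ys → x ∉ p₀ ∷ q₀ ∷ []
    outside x∈ x∈pq = unique-middle xs u (x∈pq , x∈)
    c∉ : c ∉ p₀ ∷ q₀ ∷ []
    c∉ (here e)         = c≢p₀ e
    c∉ (there (here e)) = c≢q₀ e
  ... | c' , P'cc' , (pc' , c'q) = c' , lift P'cc' , bef-insert xs pc' , bef-insert xs c'q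

  bef-tabulate⁻ : ∀ {n} (f : Fin n → A) → Bef (tabulate f) a b →
                  ∃₂ λ i j → toℕ i < toℕ j × a ≡ f i × b ≡ f j
  bef-tabulate⁻ {n = suc n} f (bef-here m) with ∈-tabulate⁻ m
  ... | j , e = fzero , fsuc j , s≤s z≤n , refl , e
  bef-tabulate⁻ {n = suc n} f (bef-there B) with bef-tabulate⁻ (f ∘ fsuc) B
  ... | i , j , i<j , e₁ , e₂ = fsuc i , fsuc j , s≤s i<j , e₁ , e₂

  bef-tabulate⁺ : ∀ {n} (f : Fin n → A) {i j : Fin n} → toℕ i < toℕ j → Bef (tabulate f) (f i) (f j)
  bef-tabulate⁺ f {fzero}  {fsuc j} _         = bef-here (∈-tabulate⁺ j)
  bef-tabulate⁺ f {fsuc i} {fsuc j} (s≤s i<j) = bef-there (bef-tabulate⁺ (f ∘ fsuc) i<j)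

module PositionOrder (n : ℕ) where
  open ListOrder {Fin n}

  bef-allFin⇒< : ∀ {a b} → Bef (allFin n) a b → toℕ a < toℕ b
  bef-allFin⇒< B with bef-tabulate⁻ id B
  ... | _ , _ , i<j , refl , refl = i<j

  <⇒bef-allFin : ∀ {a b} → toℕ a < toℕ b → Bef (allFin n) a b
  <⇒bef-allFin = bef-tabulate⁺ id

module ListIndex {A : Set} where
  private variable
    x y : A
    k : ℕ
    L L₁ L₂ : List A

  data At : List A → ℕ → A → Set where
    at-zero : ∀ {x L} → At (x ∷ L) zero x
    at-suc  : ∀ {x y L k} → At L k x → At (y ∷ L) (suc k) x

  at-lookup : (L : List A) (f : Fin (length L)) → At L (toℕ f) (lookup L f)
  at-lookup (x ∷ L) fzero    = at-zero
  at-lookup (x ∷ L) (fsuc f) = at-suc (at-lookup L f)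

  at-∈ : At L k x → x ∈ L
  at-∈ at-zero    = here refl
  at-∈ (at-suc a) = there (at-∈ a)

  at-++⁻ʳ : (L₁ : List A) → At (L₁ ++ L₂) (length L₁ + k) x → At L₂ k x
  at-++⁻ʳ []       a          = a
  at-++⁻ʳ (_ ∷ L₁) (at-suc a) = at-++⁻ʳ L₁ a

  at-++⁻ˡ : At (L₁ ++ L₂) k x → k < length L₁ → At L₁ k x
  at-++⁻ˡ {L₁ = _ ∷ _} at-zero    _         = at-zero
  at-++⁻ˡ {L₁ = _ ∷ _} (at-suc a) (s≤s k<) = at-suc (at-++⁻ˡ a k<)

  at-consecutive : At L k x → At L (suc k) y → ∃₂ λ u v → L ≡ u ++ x ∷ y ∷ v
  at-consecutive at-zero    (at-suc at-zero) = [] , _ , refl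
  at-consecutive (at-suc a) (at-suc b)       with at-consecutive a b
  ... | u , v , refl = _ ∷ u , v , refl

module ReductionMatching (G : Graph) (w : Word G) where
  open Graph G
  open ListOrder {Fin (length w)}
  open UniqueProp {A = Fin (length w)} using (Unique)
  open SubsetProp {A = Fin (length w)} using (_⊆_)
  open DisjointProp {A = Fin (length w)} using (Disjoint)

  Pos : Set
  Pos = Fin (length w)

  symbolAt : Pos → V
  symbolAt x = sym G (lookup w x)

  Dep : V → V → Set
  Dep a b = a ≢ b → ¬ I a b

  Cancels : Op G → Op G → Set
  Cancels a b = (Σ V λ o → a ≡ (o , plus) × b ≡ (o , minus))
              ⊎ (Σ V λ o → a ≡ (o , minus) × b ≡ (o , plus) × I o o)

  cancels-symbol : ∀ {a b} → Cancels a b → sym G a ≡ sym G b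
  cancels-symbol (inj₁ (_ , refl , refl))     = refl
  cancels-symbol (inj₂ (_ , refl , refl , _)) = refl

  cancels-reducible : ∀ {a b} u v → Cancels a b → ¬ Irreducible G (u ++ a ∷ b ∷ v)
  cancels-reducible u v (inj₁ (o , e₁ , e₂)) irr =
    irr (u , _ , [] , _ , v , refl , inj₁ (o , e₁ , e₂ , λ ()))
  cancels-reducible u v (inj₂ (o , e₁ , e₂ , oIo)) irr =
    irr (u , _ , [] , _ , v , refl , inj₂ (o , e₁ , e₂ , oIo , λ ()))

  swap-respects-dep : ∀ {a b x y} → Dep (symbolAt a) (symbolAt b) →
                      I (symbolAt x) (symbolAt y) → symbolAt x ≢ symbolAt y →
                      ¬ ((a ≡ x × b ≡ y) ⊎ (a ≡ y × b ≡ x))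
  swap-respects-dep dep xIy x≢y (inj₁ (refl , refl)) = dep x≢y xIy
  swap-respects-dep dep xIy x≢y (inj₂ (refl , refl)) = dep (≢-sym x≢y) (I-sym xIy)

  private variable
    s : List Pos
    p q x y z : Pos

  Partners : ∀ {s} → Red G w s → Pos → Pos → Set
  Partners ρ x y = DelTogether G ρ x y ⊎ DelTogether G ρ y x

  partners-sym : ∀ {ρ : Red G w s} → Partners ρ x y → Partners ρ y x
  partners-sym (inj₁ D) = inj₂ D
  partners-sym (inj₂ D) = inj₁ D

  del-⊆ : ∀ {ρ : Red G w s} → DelTogether G ρ x y → x ∷ y ∷ [] ⊆ s
  del-⊆ (here1 {xs = xs})    = ⊆-middle xs
  del-⊆ (here2 {xs = xs})    = ⊆-middle xs
  del-⊆ (later1 {xs = xs} D) = ⊆-insert xs ∘ del-⊆ D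
  del-⊆ (later2 {xs = xs} D) = ⊆-insert xs ∘ del-⊆ D
  del-⊆ (later3 {xs = xs} D) = ⊆-swap xs ∘ del-⊆ D

  del-cancels : ∀ {ρ : Red G w s} → DelTogether G ρ x y → Cancels (lookup w x) (lookup w y)
  del-cancels (here1 {o = o} {e₁ = e₁} {e₂ = e₂})          = inj₁ (o , e₁ , e₂)
  del-cancels (here2 {o = o} {e₁ = e₁} {e₂ = e₂} {i = i}) = inj₂ (o , e₁ , e₂ , i)
  del-cancels (later1 D) = del-cancels D
  del-cancels (later2 D) = del-cancels D
  del-cancels (later3 D) = del-cancels D

  partners-symbol : ∀ {ρ : Red G w s} → Partners ρ x y → symbolAt x ≡ symbolAt y
  partners-symbol (inj₁ D) = cancels-symbol (del-cancels D)
  partners-symbol (inj₂ D) = ≡-sym (cancels-symbol (del-cancels D))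

  del-bef : ∀ {ρ : Red G w s} → DelTogether G ρ x y → Bef s x y
  del-bef (here1 {xs = xs}) = bef-adjacent xs
  del-bef (here2 {xs = xs}) = bef-adjacent xs
  del-bef (later1 {xs = xs} D) = bef-insert xs (del-bef D)
  del-bef (later2 {xs = xs} D) = bef-insert xs (del-bef D)
  del-bef (later3 {xs = xs} {d = d} D) =
    bef-swap xs (del-bef D) λ { (refl , refl) → d (≡-sym (partners-symbol (inj₁ D))) }

  partner-exists : (ρ : Red G w s) → x ∈ s → ∃ (Partners ρ x)
  partner-exists done ()
  partner-exists {x = x} (r1 xs ys p q o e₁ e₂ ρ) x∈ with x Finₚ.≟ p | x Finₚ.≟ q
  ... | yes refl | _        = q , inj₁ here1
  ... | no _     | yes refl = p , inj₂ here1
  ... | no x≢p   | no x≢q   with partner-exists ρ (∈-delete xs x∈ λ { (here e) → x≢p e ; (there (here e)) → x≢q e })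
  ...   | y , P = y , ⊎-map later1 later1 P
  partner-exists {x = x} (r2 xs ys p q o e₁ e₂ oIo ρ) x∈ with x Finₚ.≟ p | x Finₚ.≟ q
  ... | yes refl | _        = q , inj₁ here2
  ... | no _     | yes refl = p , inj₂ here2
  ... | no x≢p   | no x≢q   with partner-exists ρ (∈-delete xs x∈ λ { (here e) → x≢p e ; (there (here e)) → x≢q e })
  ...   | y , P = y , ⊎-map later2 later2 P
  partner-exists (r3 xs ys p q pIq p≢q ρ) x∈ with partner-exists ρ (⊆-swap xs x∈)
  ... | y , P = y , ⊎-map later3 later3 P

  later-apart : ∀ xs {ys p₀ q₀} {ρ : Red G w (xs ++ ys)} → Unique (xs ++ p₀ ∷ q₀ ∷ ys) →
                DelTogether G ρ x y → Disjoint (p₀ ∷ q₀ ∷ []) (x ∷ y ∷ [])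
  later-apart xs u D (v∈₀ , v∈) = unique-middle xs u (v∈₀ , del-⊆ D v∈)

  del-unique : ∀ {a b a' b'} {ρ : Red G w s} → Unique s →
               DelTogether G ρ a b → DelTogether G ρ a' b' →
               ¬ Disjoint (a ∷ b ∷ []) (a' ∷ b' ∷ []) → a ≡ a' × b ≡ b'
  del-unique u here1 here1 _ = refl , refl
  del-unique u here2 here2 _ = refl , refl
  del-unique u (here1 {xs = xs}) (later1 D) meet = ⊥-elim (meet (later-apart xs u D))
  del-unique u (here2 {xs = xs}) (later2 D) meet = ⊥-elim (meet (later-apart xs u D))
  del-unique u (later1 {xs = xs} D) here1 meet = ⊥-elim (meet λ (v∈ , v∈₀) → later-apart xs u D (v∈₀ , v∈))
  del-unique u (later2 {xs = xs} D) here2 meet = ⊥-elim (meet λ (v∈ , v∈₀) → later-apart xs u D (v∈₀ , v∈))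
  del-unique u (later1 {xs = xs} D) (later1 D') meet = del-unique (unique-delete xs u) D D' meet
  del-unique u (later2 {xs = xs} D) (later2 D') meet = del-unique (unique-delete xs u) D D' meet
  del-unique u (later3 {xs = xs} D) (later3 D') meet = del-unique (unique-swap xs u) D D' meet

  partners-functional : ∀ {ρ : Red G w s} → Unique s → Partners ρ x y → Partners ρ x z → y ≡ z
  partners-functional u (inj₁ D) (inj₁ D') =
    proj₂ (del-unique u D D' λ dis → dis (here refl , here refl))
  partners-functional u (inj₁ D) (inj₂ D') with del-unique u D D' (λ dis → dis (here refl , there (here refl)))
  ... | refl , refl = refl
  partners-functional u (inj₂ D) (inj₁ D') with del-unique u D D' (λ dis → dis (there (here refl) , here refl))
  ... | refl , refl = refl
  partners-functional u (inj₂ D) (inj₂ D') =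
    proj₁ (del-unique u D D' λ dis → dis (there (here refl) , there (here refl)))

  -- partners carry the same symbol, so dependence is inherited along partners
  dep-partnerˡ : ∀ {a} {ρ : Red G w s} → Partners ρ x y → Dep (symbolAt x) a → Dep (symbolAt y) a
  dep-partnerˡ P = subst (λ v → Dep v _) (partners-symbol P)

  dep-partnerʳ : ∀ {a} {ρ : Red G w s} → Partners ρ x y → Dep a (symbolAt x) → Dep a (symbolAt y)
  dep-partnerʳ P = subst (Dep _) (partners-symbol P)

  nested : ∀ {c} {ρ : Red G w s} → Unique s → DelTogether G ρ p q → Between s p q c →
           Dep (symbolAt c) (symbolAt p) → ∃ λ c' → Partners ρ c c' × Between s p q c'
  nested u (here1 {xs = xs}) btw _ = ⊥-elim (nothing-between-adjacent xs u btw)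
  nested u (here2 {xs = xs}) btw _ = ⊥-elim (nothing-between-adjacent xs u btw)
  nested u (later1 {xs = xs} D) btw dep =
    between-across-deletion Finₚ._≟_ xs u (inj₁ here1) (inj₂ here1) (⊎-map later1 later1)
      (del-⊆ D (here refl)) (del-⊆ D (there (here refl)))
      (λ btw' → nested (unique-delete xs u) D btw' dep) btw
  nested u (later2 {xs = xs} D) btw dep =
    between-across-deletion Finₚ._≟_ xs u (inj₁ here2) (inj₂ here2) (⊎-map later2 later2)
      (del-⊆ D (here refl)) (del-⊆ D (there (here refl)))
      (λ btw' → nested (unique-delete xs u) D btw' dep) btw
  nested {p = p} {q = q} {c = c} u (later3 {xs = xs} {i = pIq} {d = p≢q} D) (pc , cq) dep
    with nested (unique-swap xs u) D
           (bef-swap xs pc (λ (e₁ , e₂) → swap-respects-dep dep pIq p≢q (inj₂ (e₂ , e₁))) ,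
            bef-swap xs cq (λ (e₁ , e₂) → swap-respects-dep (dep-partnerʳ (inj₁ D) dep) pIq p≢q (inj₁ (e₁ , e₂))))
           dep
  ... | c' , P , (pc' , c'q) =
    c' , ⊎-map later3 later3 P ,
    bef-swap xs pc' (λ (e₁ , e₂) → swap-respects-dep dep' pIq p≢q (inj₁ (e₂ , e₁))) ,
    bef-swap xs c'q (λ (e₁ , e₂) → swap-respects-dep (dep-partnerʳ (inj₁ D) dep') pIq p≢q (inj₂ (e₁ , e₂)))
    where
    dep' : Dep (symbolAt c') (symbolAt p)
    dep' = dep-partnerˡ P dep

record MatchingStructure : Set₁ where
  field
    Pos          : Set
    _≺_          : Pos → Pos → Set
    ≺-trans      : Transitive _≺_
    ≺-cmp        : Trichotomous _≡_ _≺_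
    Ctx          : Set
    In           : Ctx → Pos → Set
    in-convex    : ∀ {i a b c} → In i a → In i c → a ≺ b → b ≺ c → In i b
    _~_          : Pos → Pos → Set
    ~-sym        : ∀ {a b} → a ~ b → b ~ a
    ~-functional : ∀ {a b c} → a ~ b → a ~ c → b ≡ c
    ~-total      : ∀ {i a} → In i a → ∃ (a ~_)
    Dep          : Pos → Pos → Set
    dep-ctx      : ∀ {i a b} → In i a → In i b → Dep a b
    dep-~ˡ       : ∀ {a a' b} → a ~ a' → Dep a b → Dep a' b
    dep-~ʳ       : ∀ {a b b'} → b ~ b' → Dep a b → Dep a b'
    nested       : ∀ {a b c} → a ~ b → a ≺ c → c ≺ b → Dep c a → ∃ λ c' → c ~ c' × a ≺ c' × c' ≺ b
    separated    : ∀ {i a b} → a ~ b → In i a → In i b → ⊥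

flipped : MatchingStructure → MatchingStructure
flipped M = record M
  { _≺_       = flip _≺_
  ; ≺-trans   = flip ≺-trans
  ; ≺-cmp     = flip-cmp
  ; in-convex = λ ia ic b≺a c≺b → in-convex ic ia c≺b b≺a
  ; nested    = λ ab b≺a c≺b dep → flip-nested (nested (~-sym ab) c≺b b≺a (dep-~ʳ ab dep))
  }
  where
  open MatchingStructure M
  flip-cmp : Trichotomous _≡_ (flip _≺_)
  flip-cmp a b with ≺-cmp a b
  ... | tri< a≺b a≢b ¬b≺a = tri> ¬b≺a a≢b a≺b
  ... | tri≈ ¬a≺b a≡b ¬b≺a = tri≈ ¬b≺a a≡b ¬a≺b
  ... | tri> ¬a≺b a≢b b≺a = tri< b≺a a≢b ¬a≺b
  flip-nested : ∀ {a b c} → (∃ λ c' → c ~ c' × b ≺ c' × c' ≺ a) → ∃ λ c' → c ~ c' × c' ≺ a × b ≺ c'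
  flip-nested (c' , cc' , b≺c' , c'≺a) = c' , cc' , c'≺a , b≺c'

module MatchingLemmas (M : MatchingStructure) where
  open MatchingStructure M

  ≺-irrefl : ∀ {a} → ¬ a ≺ a
  ≺-irrefl {a} a≺a with ≺-cmp a a
  ... | tri< _ a≢a _  = a≢a refl
  ... | tri≈ ¬a≺a _ _ = ¬a≺a a≺a
  ... | tri> _ a≢a _  = a≢a refl

  ≺-asym : ∀ {a b} → a ≺ b → ¬ b ≺ a
  ≺-asym a≺b b≺a = ≺-irrefl (≺-trans a≺b b≺a)

  Adjacent : Pos → Pos → Set
  Adjacent a b = a ≺ b × (∀ {d} → a ≺ d → d ≺ b → ⊥)

  inner-partner : ∀ {x y c c'} → x ~ y → x ≺ c → c ≺ y → Dep c x → c ~ c' → x ≺ c' × c' ≺ y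
  inner-partner xy x≺c c≺y dep cc' with nested xy x≺c c≺y dep
  ... | c'' , cc'' , x≺c'' , c''≺y with ~-functional cc' cc''
  ... | refl = x≺c'' , c''≺y

  separation : ∀ {i j x y x' y'} → x ~ y → x' ~ y' → In i x → In i x' → In j y → In j y' →
               x ≺ y → x' ≺ y'
  separation {x' = x'} {y' = y'} xy x'y' ix ix' iy iy' x≺y with ≺-cmp x' y'
  ... | tri< x'≺y' _ _ = x'≺y'
  ... | tri≈ _ refl _  = ⊥-elim (separated x'y' ix' ix')
  separation {y = y} {x' = x'} xy x'y' ix ix' iy iy' x≺y | tri> _ _ y'≺x' with ≺-cmp x' y
  ...   | tri< x'≺y _ _ = ⊥-elim (separated x'y' (in-convex iy' iy y'≺x' x'≺y) iy')
  ...   | tri≈ _ refl _ = ⊥-elim (separated xy ix ix')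
  ...   | tri> _ _ y≺x' = ⊥-elim (separated xy ix (in-convex ix ix' x≺y y≺x'))

  passes-context : ∀ {i x y x₂} → x ~ y → In i x → In i x₂ → x ≺ x₂ → x ≺ y → x₂ ≺ y
  passes-context {y = y} {x₂ = x₂} xy ix ix₂ x≺x₂ x≺y with ≺-cmp x₂ y
  ... | tri< x₂≺y _ _ = x₂≺y
  ... | tri≈ _ refl _ = ⊥-elim (separated xy ix ix₂)
  ... | tri> _ _ y≺x₂ = ⊥-elim (separated xy ix (in-convex ix ix₂ x≺y y≺x₂))

  module TwoPairs {i j x y x₂ y₂} (ix : In i x) (ix₂ : In i x₂) (iy : In j y) (iy₂ : In j y₂)
                  (xy : x ~ y) (x₂y₂ : x₂ ~ y₂) (x≺x₂ : x ≺ x₂) (x≺y : x ≺ y) where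

    x₂≺y : x₂ ≺ y
    x₂≺y = passes-context xy ix ix₂ x≺x₂ x≺y

    x₂≺y₂ : x₂ ≺ y₂
    x₂≺y₂ = separation xy x₂y₂ ix ix₂ iy iy₂ x≺y

    y₂≺y : y₂ ≺ y
    y₂≺y = proj₂ (inner-partner xy x≺x₂ x₂≺y (dep-ctx ix₂ ix) x₂y₂)

    module _ {c} (adj : Adjacent x c) where

      c-in : In i c × (c ≡ x₂ ⊎ c ≺ x₂)
      c-in with ≺-cmp c x₂
      ... | tri< c≺x₂ _ _ = in-convex ix ix₂ (proj₁ adj) c≺x₂ , inj₂ c≺x₂
      ... | tri≈ _ refl _ = ix₂ , inj₁ refl
      ... | tri> _ _ x₂≺c = ⊥-elim (proj₂ adj x≺x₂ x₂≺c)

      ic : In i c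
      ic = proj₁ c-in

      module _ {c'} (cc' : c ~ c') where

        c'-in : In j c' × x₂ ≺ c' × c' ≺ y
        c'-in with proj₂ c-in
        ... | inj₁ refl with ~-functional cc' x₂y₂
        ...   | refl = iy₂ , x₂≺y₂ , y₂≺y
        c'-in | inj₂ c≺x₂ with inner-partner xy (proj₁ adj) (≺-trans c≺x₂ x₂≺y) (dep-ctx ic ix) cc'
        -- c' not after x₂ would put c' into context i, together with c
        ... | x≺c' , c'≺y with ≺-cmp c' x₂
        ...   | tri< c'≺x₂ _ _ = ⊥-elim (separated cc' ic (in-convex ix ix₂ x≺c' c'≺x₂))
        ...   | tri≈ _ refl _  = ⊥-elim (separated cc' ic ix₂)
        -- c' before y₂ would put the partner c of c' between x₂ and y₂; c' = y₂ would give c = x₂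
        ...   | tri> _ _ x₂≺c' with ≺-cmp c' y₂
        ...     | tri< c'≺y₂ _ _ = ⊥-elim (≺-asym c≺x₂ (proj₁ (inner-partner x₂y₂ x₂≺c' c'≺y₂ c'-dep (~-sym cc'))))
          where
          c'-dep : Dep c' x₂
          c'-dep = dep-~ˡ cc' (dep-ctx ic ix₂)
        ...     | tri≈ _ refl _  = ⊥-elim (≺-irrefl (subst (_≺ x₂) (~-functional (~-sym cc') (~-sym x₂y₂)) c≺x₂))
        ...     | tri> _ _ y₂≺c' = in-convex iy₂ iy y₂≺c' c'≺y , x₂≺c' , c'≺y

        ic' : In j c'
        ic' = proj₁ c'-in

        x₂≺c' : x₂ ≺ c'
        x₂≺c' = proj₁ (proj₂ c'-in)

        c'≺y : c' ≺ y
        c'≺y = proj₂ (proj₂ c'-in)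

        -- A position d of context j strictly between c' and y has its partner d' strictly
        -- between x and y; d' cannot precede or equal c (c follows x), lie strictly between c
        -- and c' (then d would too), equal c' (then d = c), nor follow c' (then d' would share
        -- context j with d).
        nothing-between : ∀ {d} → c' ≺ d → d ≺ y → In j d → ⊥
        nothing-between c'≺d d≺y id
          with nested xy (≺-trans x≺x₂ (≺-trans x₂≺c' c'≺d)) d≺y (dep-~ʳ (~-sym xy) (dep-ctx id iy))
        ... | d' , dd' , x≺d' , d'≺y with ≺-cmp d' c
        ...   | tri< d'≺c _ _ = proj₂ adj x≺d' d'≺c
        ...   | tri≈ _ refl _ = ≺-irrefl (subst (c' ≺_) (~-functional (~-sym dd') cc') c'≺d)
        ...   | tri> _ _ c≺d' with ≺-cmp d' c'
        ...     | tri< d'≺c' _ _ with nested cc' c≺d' d'≺c' (dep-~ˡ dd' (dep-~ʳ (~-sym cc') (dep-ctx id ic')))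
        ...       | z , d'z , _ , z≺c' = ≺-asym c'≺d (subst (_≺ c') (~-functional d'z (~-sym dd')) z≺c')
        nothing-between c'≺d _ _ | d' , dd' , _ , _ | tri> _ _ c≺d' | tri≈ _ refl _ =
          ≺-asym c≺d' (subst (c' ≺_) (~-functional (~-sym dd') (~-sym cc')) c'≺d)
        nothing-between c'≺d d≺y id | d' , dd' , _ , d'≺y | tri> _ _ _ | tri> _ _ c'≺d' =
          separated dd' id (in-convex ic' iy c'≺d' d'≺y)

        c'-adjacent : Adjacent c' y
        c'-adjacent = c'≺y , λ c'≺d d≺y → nothing-between c'≺d d≺y (in-convex ic' iy c'≺d d≺y)

      next-partner : ∃ λ c' → c ~ c' × In i c × In j c' × Adjacent c' y
      next-partner with ~-total ic
      ... | c' , cc' = c' , cc' , ic , ic' cc' , c'-adjacent cc'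

module _ {G : Graph} where

  decomp-concat : ∀ {w cs} → Decomp G w cs → w ≡ concat cs
  decomp-concat (one {w = w} _ _)     = ≡-sym (++-identityʳ w)
  decomp-concat (more {p = p} _ _ dc) = cong (p ++_) (decomp-concat dc)

  decomp-dependent : ∀ {w cs} → Decomp G w cs → All (Dependent G) cs
  decomp-dependent (one _ dep)             = dep ∷ []
  decomp-dependent (more _ (_ , dep , _) dc) = dep ∷ decomp-dependent dc

module Contexts (G : Graph) {w : Word G} {cs : List (Word G)} (dc : Decomp G w cs) where
  open ListIndex {Op G}

  Ctx : Set
  Ctx = Fin (length cs)

  start : Ctx → ℕ
  start = ctxStart G cs

  ctx : Ctx → Word G
  ctx = lookup cs

  end : Ctx → ℕ
  end i = start i + length (ctx i)

  In : Ctx → ℕ → Set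
  In i n = start i ≤ n × n < end i

  in-convex : ∀ {i a b c} → In i a → In i c → a < b → b < c → In i b
  in-convex (s≤a , _) (_ , c<e) a<b b<c = ℕₚ.≤-trans s≤a (ℕₚ.<⇒≤ a<b) , ℕₚ.<-trans b<c c<e

  prefix suffix : Ctx → Word G
  prefix i = concat (take (toℕ i) cs)
  suffix i = concat (drop (suc (toℕ i)) cs)

  w-split : ∀ i → w ≡ prefix i ++ (ctx i ++ suffix i)
  w-split i = trans (decomp-concat dc) (concat-split cs i)
    where
    concat-split : ∀ (xss : List (Word G)) (i : Fin (length xss)) →
                   concat xss ≡ concat (take (toℕ i) xss) ++ (lookup xss i ++ concat (drop (suc (toℕ i)) xss))
    concat-split (xs ∷ xss) fzero    = refl
    concat-split (xs ∷ xss) (fsuc i) =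
      trans (cong (xs ++_) (concat-split xss i)) (≡-sym (++-assoc xs (concat (take (toℕ i) xss)) _))

  length-prefix : ∀ i → length (prefix i) ≡ start i
  length-prefix i = length-concat-take cs (toℕ i)
    where
    length-concat-take : ∀ (xss : List (Word G)) k →
                         length (concat (take k xss)) ≡ sum (map length (take k xss))
    length-concat-take []         zero    = refl
    length-concat-take []         (suc k) = refl
    length-concat-take (xs ∷ xss) zero    = refl
    length-concat-take (xs ∷ xss) (suc k) =
      trans (length-++ xs) (cong (length xs +_) (length-concat-take xss k))

  in-bound : ∀ {i n} → In i n → n < length w
  in-bound {i} (_ , n<e) =
    ℕₚ.<-≤-trans n<e (ℕₚ.≤-trans (ℕₚ.m≤m+n _ (length (suffix i))) (ℕₚ.≤-reflexive (≡-sym length-w)))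
    where
    length-w : length w ≡ start i + length (ctx i) + length (suffix i)
    length-w = begin
      length w                                                ≡⟨ cong length (w-split i) ⟩
      length (prefix i ++ (ctx i ++ suffix i))                ≡⟨ length-++ (prefix i) ⟩
      length (prefix i) + length (ctx i ++ suffix i)          ≡⟨ cong₂ _+_ (length-prefix i) (length-++ (ctx i)) ⟩
      start i + (length (ctx i) + length (suffix i))          ≡⟨ ≡-sym (ℕₚ.+-assoc (start i) _ _) ⟩
      start i + length (ctx i) + length (suffix i)            ∎
      where open ≡-Reasoning

  at-context : ∀ {i n x} → In i n → At w n x → At (ctx i) (n ∸ start i) x
  at-context {i} {n} {x} (s≤n , n<e) a =
    at-++⁻ˡ (at-++⁻ʳ (prefix i) (subst₂ (λ L k → At L k x) (w-split i) n≡ a)) k<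
    where
    n≡ : n ≡ length (prefix i) + (n ∸ start i)
    n≡ = trans (≡-sym (ℕₚ.m+[n∸m]≡n s≤n)) (cong (_+ (n ∸ start i)) (≡-sym (length-prefix i)))
    k< : n ∸ start i < length (ctx i)
    k< = subst (n ∸ start i <_) (ℕₚ.m+n∸m≡n (start i) _) (ℕₚ.∸-monoˡ-< n<e s≤n)

module PositionMatching (G : Graph) {w : Word G} {cs : List (Word G)} (dc : Decomp G w cs)
                        (irr : All (Irreducible G) cs) (π : Reduction G w) where
  open ReductionMatching G w
  open Contexts G dc
  open ListIndex {Op G}
  open PositionOrder (length w)

  position : ∀ {n} → n < length w → Σ Pos λ x → toℕ x ≡ n
  position n< = fromℕ< n< , Finₚ.toℕ-fromℕ< n<

  _~_ : ℕ → ℕ → Set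
  n ~ m = Σ Pos λ x → Σ Pos λ y → toℕ x ≡ n × toℕ y ≡ m × Partners π x y

  DepAt : ℕ → ℕ → Set
  DepAt n m = ∀ {x y : Pos} → toℕ x ≡ n → toℕ y ≡ m → Dep (symbolAt x) (symbolAt y)

  del-< : ∀ {x y} → DelTogether G π x y → toℕ x < toℕ y
  del-< D = bef-allFin⇒< (del-bef D)

  ~-sym : ∀ {n m} → n ~ m → m ~ n
  ~-sym (x , y , ex , ey , P) = y , x , ey , ex , partners-sym P

  ~-functional : ∀ {n m m'} → n ~ m → n ~ m' → m ≡ m'
  ~-functional (x , y , refl , refl , P) (x' , y' , ex' , refl , P') with Finₚ.toℕ-injective ex'
  ... | refl = cong toℕ (partners-functional (allFin⁺ _) P P')

  ~-ordered : ∀ {n m} → n ~ m → n < m ⊎ m < n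
  ~-ordered (x , y , refl , refl , inj₁ D) = inj₁ (del-< D)
  ~-ordered (x , y , refl , refl , inj₂ D) = inj₂ (del-< D)

  matched-exists : ∀ {n} → n < length w → ∃ (n ~_)
  matched-exists n< with position n<
  ... | x , refl with partner-exists π (∈-allFin x)
  ... | y , P = toℕ y , x , y , refl , refl , P

  dep-~ˡ : ∀ {a a' b} → a ~ a' → DepAt a b → DepAt a' b
  dep-~ˡ (u , v , refl , refl , P) dep ex ey with Finₚ.toℕ-injective ex
  ... | refl = dep-partnerˡ P (dep refl ey)

  dep-~ʳ : ∀ {a b b'} → b ~ b' → DepAt a b → DepAt a b'
  dep-~ʳ (u , v , refl , refl , P) dep ex ey with Finₚ.toℕ-injective ey
  ... | refl = dep-partnerʳ P (dep ex refl)

  symbol-in-context : ∀ {i} x → In i (toℕ x) → symbolAt x ∈ symbols G (ctx i)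
  symbol-in-context x ix = ∈-map⁺ (sym G) (at-∈ (at-context ix (at-lookup w x)))

  -- contexts are dependent words
  dep-ctx : ∀ {i n m} → In i n → In i m → DepAt n m
  dep-ctx {i} in' im {x} {y} refl refl =
    All.lookup (decomp-dependent dc) (∈-lookup i) (symbol-in-context x in') (symbol-in-context y im)

  nested-positions : ∀ {a b c} → a ~ b → a < c → c < b → DepAt c a → ∃ λ c' → c ~ c' × a < c' × c' < b
  nested-positions (x , y , refl , refl , inj₂ D) a<c c<b _ =
    ⊥-elim (ℕₚ.<-asym (ℕₚ.<-trans a<c c<b) (del-< D))
  nested-positions (x , y , refl , refl , inj₁ D) a<c c<b dep
    with position (ℕₚ.<-trans c<b (Finₚ.toℕ<n y))
  ... | z , refl with nested (allFin⁺ _) D (<⇒bef-allFin a<c , <⇒bef-allFin c<b) (dep refl refl)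
  ... | z' , P , (xz' , z'y) = toℕ z' , (z , z' , refl , refl , P) , bef-allFin⇒< xz' , bef-allFin⇒< z'y

  -- two adjacent letters of a context are not deleted together, as the context is irreducible
  adjacent-unmatched : ∀ {i n} → n ~ suc n → In i n → In i (suc n) → ⊥
  adjacent-unmatched (x , y , refl , ey , inj₂ D) _ _ =
    ℕₚ.<-asym (del-< D) (subst (toℕ x <_) (≡-sym ey) (ℕₚ.n<1+n _))
  adjacent-unmatched {i} (x , y , refl , ey , inj₁ D) ix iy
    with at-consecutive (at-context ix (at-lookup w x))
                        (subst (λ k → At (ctx i) k (lookup w y)) next
                               (at-context (subst (In i) (≡-sym ey) iy) (at-lookup w y)))
    where
    next : toℕ y ∸ start i ≡ suc (toℕ x ∸ start i)
    next = trans (cong (_∸ start i) ey) (ℕₚ.+-∸-assoc 1 (proj₁ ix))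
  ... | u , v , ctx≡ =
    cancels-reducible u v (del-cancels D) (subst (Irreducible G) ctx≡ (All.lookup irr (∈-lookup i)))

  inner-pair : ∀ {i n m} → n ~ m → suc n < m → In i n → In i m →
               ∃₂ λ a b → a ~ b × a < b × In i a × In i b × n < a × b < m
  inner-pair {n = n} nm sn<m in' im
    with nested-positions nm (ℕₚ.n<1+n n) sn<m (dep-ctx (in-convex in' im (ℕₚ.n<1+n n) sn<m) in')
  ... | c' , cc' , n<c' , c'<m with ~-ordered cc'
  ...   | inj₁ c<c' = suc n , c' , cc' , c<c' , in-convex in' im (ℕₚ.n<1+n n) sn<m ,
                      in-convex in' im n<c' c'<m , ℕₚ.n<1+n n , c'<m
  ...   | inj₂ c'<c = c' , suc n , ~-sym cc' , c'<c , in-convex in' im n<c' c'<m ,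
                      in-convex in' im (ℕₚ.n<1+n n) sn<m , n<c' , sn<m

  context-unmatched-within : ∀ k {i n m} → m ≤ n + k → n < m → n ~ m → In i n → In i m → ⊥
  context-unmatched-within zero {n = n} m≤ n<m _ _ _ =
    ℕₚ.<-irrefl refl (ℕₚ.<-≤-trans n<m (subst (_ ≤_) (ℕₚ.+-identityʳ n) m≤))
  context-unmatched-within (suc k) {n = n} {m} m≤ n<m nm in' im with ℕₚ.m≤n⇒m<n∨m≡n n<m
  ... | inj₂ refl = adjacent-unmatched nm in' im
  ... | inj₁ sn<m with inner-pair nm sn<m in' im
  ...   | a , b , ab , a<b , ia , ib , n<a , b<m = context-unmatched-within k b≤a+k a<b ab ia ib
    where
    b≤a+k : b ≤ a + k
    b≤a+k = ℕₚ.≤-trans (ℕₚ.≤-pred (ℕₚ.≤-trans b<m (subst (m ≤_) (ℕₚ.+-suc n k) m≤)))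
                       (ℕₚ.+-monoˡ-≤ k (ℕₚ.<⇒≤ n<a))

  context-unmatched : ∀ {i n m} → n ~ m → In i n → In i m → ⊥
  context-unmatched {n = n} {m} nm in' im with ~-ordered nm
  ... | inj₁ n<m = context-unmatched-within m (ℕₚ.m≤n+m m n) n<m nm in' im
  ... | inj₂ m<n = context-unmatched-within n (ℕₚ.m≤n+m n m) m<n (~-sym nm) im in'

  matching : MatchingStructure
  matching = record
    { Pos = ℕ ; _≺_ = _<_ ; ≺-trans = ℕₚ.<-trans ; ≺-cmp = ℕₚ.<-cmp
    ; Ctx = Ctx ; In = In ; in-convex = in-convex
    ; _~_ = _~_ ; ~-sym = ~-sym ; ~-functional = ~-functional
    ; ~-total = matched-exists ∘ in-bound
    ; Dep = DepAt ; dep-ctx = dep-ctx ; dep-~ˡ = dep-~ˡ ; dep-~ʳ = dep-~ʳ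
    ; nested = nested-positions ; separated = context-unmatched
    }

module Blocks (G : Graph) {w : Word G} {cs : List (Word G)} (dc : Decomp G w cs)
              (irr : All (Irreducible G) cs) (π : Reduction G w) where
  open Contexts G dc using (In; end; in-bound)
  open PositionMatching G dc irr π using (_~_; matched-exists; matching)
  open MatchingStructure matching using (separated)
  module Forward  = MatchingLemmas matching
  module Backward = MatchingLemmas (flipped matching)

  Last : Infix G → ℕ → Set
  Last (a , ℓ) e = suc e ≡ a + ℓ

  record Ends (u v : Infix G) : Set where
    field
      lastᵤ lastᵥ : ℕ
      lastᵤ-is    : Last u lastᵤ
      lastᵥ-is    : Last v lastᵥ
      first~last  : proj₁ u ~ lastᵥ
      last~first  : lastᵤ ~ proj₁ v

  ends : ∀ {u v} → Rπ G cs π u v → Ends u v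
  ends (base {x} {y} D)  = record
    { lastᵤ = toℕ x ; lastᵥ = toℕ y
    ; lastᵤ-is = ≡-sym (ℕₚ.+-comm _ 1) ; lastᵥ-is = ≡-sym (ℕₚ.+-comm _ 1)
    ; first~last = x , y , refl , refl , inj₁ D ; last~first = x , y , refl , refl , inj₁ D }
  ends (base' {x} {y} D) = record
    { lastᵤ = toℕ y ; lastᵥ = toℕ x
    ; lastᵤ-is = ≡-sym (ℕₚ.+-comm _ 1) ; lastᵥ-is = ≡-sym (ℕₚ.+-comm _ 1)
    ; first~last = y , x , refl , refl , inj₂ D ; last~first = y , x , refl , refl , inj₂ D }
  ends (step {a} {k} {m} {b} {m'} {k'} R₁ R₂ _ _) = record
    { lastᵤ = E₁.lastᵤ ; lastᵥ = E₂.lastᵥ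
    ; lastᵤ-is = trans E₁.lastᵤ-is (ℕₚ.+-assoc a k m)
    ; lastᵥ-is = trans E₂.lastᵥ-is (ℕₚ.+-assoc b m' k')
    ; first~last = E₂.first~last ; last~first = E₁.last~first }
    where
    module E₁ = Ends (ends R₁)
    module E₂ = Ends (ends R₂)

  to-Rπ : ∀ {n m} → n ~ m → Rπ G cs π (n , 1) (m , 1)
  to-Rπ (x , y , refl , refl , inj₁ D) = base D
  to-Rπ (x , y , refl , refl , inj₂ D) = base' D

  inCtx-first : ∀ {i a ℓ} → InCtx G cs i (a , ℓ) → In i a
  inCtx-first {a = a} (1≤ℓ , s≤a , a+ℓ≤e) = s≤a , ℕₚ.<-≤-trans (ℕₚ.m<m+n a 1≤ℓ) a+ℓ≤e

  inCtx-last : ∀ {i u e} → InCtx G cs i u → Last u e → In i e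
  inCtx-last {i} {u = a , ℓ} (1≤ℓ , s≤a , a+ℓ≤e) last =
    ℕₚ.≤-trans s≤a (ℕₚ.≤-pred (subst (a <_) (≡-sym last) (ℕₚ.m<m+n a 1≤ℓ))) ,
    subst (_≤ end i) (≡-sym last) a+ℓ≤e

  inCtx-snoc : ∀ {i a ℓ} → InCtx G cs i (a , ℓ) → In i (a + ℓ) → InCtx G cs i (a , ℓ + 1)
  inCtx-snoc {i} {a} {ℓ} (1≤ℓ , s≤a , _) (_ , a+ℓ<e) =
    ℕₚ.≤-trans 1≤ℓ (ℕₚ.m≤m+n ℓ 1) , s≤a ,
    subst (_≤ end i) (trans (ℕₚ.+-comm 1 (a + ℓ)) (ℕₚ.+-assoc a ℓ 1)) a+ℓ<e

  inCtx-cons : ∀ {i a ℓ} → InCtx G cs i (suc a , ℓ) → In i a → InCtx G cs i (a , 1 + ℓ)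
  inCtx-cons {i} {a} {ℓ} (_ , _ , a+ℓ≤e) (s≤a , _) =
    s≤s z≤n , s≤a , subst (_≤ end i) (≡-sym (ℕₚ.+-suc a ℓ)) a+ℓ≤e

  no-right-extension : ∀ {i a ℓ} → Block G cs π i (a , ℓ) → ¬ Cluster G cs π i (a , ℓ + 1)
  no-right-extension {a = a} {ℓ} (_ , maximal) cl =
    ℕₚ.1+n≢n (trans (ℕₚ.+-comm 1 ℓ) (≡-sym (cong proj₂ (maximal _ cl (ℕₚ.≤-refl , ℕₚ.+-monoʳ-≤ a (ℕₚ.m≤m+n ℓ 1))))))

  no-left-extension : ∀ {i a ℓ} → Block G cs π i (suc a , ℓ) → ¬ Cluster G cs π i (a , 1 + ℓ)
  no-left-extension {a = a} {ℓ} (_ , maximal) cl =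
    ℕₚ.1+n≢n (cong proj₁ (maximal _ cl (ℕₚ.n≤1+n a , ℕₚ.≤-reflexive (≡-sym (ℕₚ.+-suc a ℓ)))))

  -- If the letter c after a block is matched with the letter c' before the infix related
  -- to the block, the block extends by c, contradicting maximality.
  extend-right : ∀ {i j a ℓ b m c c'} → Block G cs π i (a , ℓ) → InCtx G cs j (b , m) →
                 Rπ G cs π (a , ℓ) (b , m) → c ≡ a + ℓ → b ≡ suc c' → In i c → In j c' → c ~ c' → ⊥
  extend-right {i} {j} {a} {ℓ} {m = m} {c' = c'} bl icj R refl refl ic ic' cc' =
    no-right-extension bl (icᵢ , j , (c' , 1 + m) , icⱼ ,
      step (to-Rπ cc') (subst (λ z → Rπ G cs π (a , ℓ) (z , m)) (ℕₚ.+-comm 1 c') R) (i , icᵢ) (j , icⱼ))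
    where
    icᵢ : InCtx G cs i (a , ℓ + 1)
    icᵢ = inCtx-snoc (proj₁ (proj₁ bl)) ic
    icⱼ : InCtx G cs j (c' , 1 + m)
    icⱼ = inCtx-cons icj ic'

  extend-left : ∀ {i j a ℓ b m c c'} → Block G cs π i (a , ℓ) → InCtx G cs j (b , m) →
                Rπ G cs π (a , ℓ) (b , m) → a ≡ suc c → c' ≡ b + m → In i c → In j c' → c ~ c' → ⊥
  extend-left {i} {j} {ℓ = ℓ} {b} {m} {c} bl icj R refl refl ic ic' cc' =
    no-left-extension bl (icᵢ , j , (b , m + 1) , icⱼ ,
      step (subst (λ z → Rπ G cs π (z , ℓ) (b , m)) (ℕₚ.+-comm 1 c) R) (to-Rπ cc') (i , icᵢ) (j , icⱼ))
    where
    icᵢ : InCtx G cs i (c , 1 + ℓ)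
    icᵢ = inCtx-cons (proj₁ (proj₁ bl)) ic
    icⱼ : InCtx G cs j (b , m + 1)
    icⱼ = inCtx-snoc icj ic'

  adjacent-suc : ∀ n → Forward.Adjacent n (suc n)
  adjacent-suc n = ℕₚ.n<1+n n , λ n<d d<sn → ℕₚ.<-irrefl refl (ℕₚ.<-≤-trans n<d (ℕₚ.≤-pred d<sn))

  adjacent⇒suc : ∀ {a b} → Forward.Adjacent a b → b ≡ suc a
  adjacent⇒suc {a} (a<b , nothing-between) with ℕₚ.m≤n⇒m<n∨m≡n a<b
  ... | inj₁ sa<b = ⊥-elim (nothing-between (ℕₚ.n<1+n a) sa<b)
  ... | inj₂ sa≡b = ≡-sym sa≡b

  backward-adjacent : ∀ {a b} → Forward.Adjacent b a → Backward.Adjacent a b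
  backward-adjacent (b<a , nothing-between) = b<a , λ d<a b<d → nothing-between b<d d<a

  forward-adjacent : ∀ {a b} → Backward.Adjacent a b → Forward.Adjacent b a
  forward-adjacent (b<a , nothing-between) = b<a , λ b<d d<a → nothing-between d<a b<d

  -- If the last letter e of a block is matched forwards, with the first letter b of the
  -- related infix, and some later letter of the block's context is matched into the
  -- context of b, then the letter after e extends the block: a contradiction.
  forward-extension : ∀ {i j a ℓ b m e x₂ y₂} → Block G cs π i (a , ℓ) → InCtx G cs j (b , m) →
                      Rπ G cs π (a , ℓ) (b , m) → Last (a , ℓ) e → e ~ b → e < b →
                      In i x₂ → In j y₂ → x₂ ~ y₂ → e < x₂ → ⊥
  forward-extension {i} {j} {b = b} {e = e} bl icj R last e~b e<b ix₂ iy₂ x₂~y₂ e<x₂ =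
    extend (Forward.TwoPairs.next-partner (inCtx-last (proj₁ (proj₁ bl)) last) ix₂ (inCtx-first icj) iy₂
              e~b x₂~y₂ e<x₂ e<b (adjacent-suc e))
    where
    extend : (∃ λ c' → suc e ~ c' × In i (suc e) × In j c' × Forward.Adjacent c' b) → ⊥
    extend (c' , cc' , ic , ic' , c'-adjacent) = extend-right bl icj R last (adjacent⇒suc c'-adjacent) ic ic' cc'

  backward-extension : ∀ {i j c ℓ b m f x₂ y₂} → Block G cs π i (suc c , ℓ) → InCtx G cs j (b , m) →
                       Rπ G cs π (suc c , ℓ) (b , m) → Last (b , m) f → suc c ~ f → f < suc c →
                       In i x₂ → In j y₂ → x₂ ~ y₂ → x₂ < suc c → ⊥
  backward-extension {i} {j} {c} {f = f} bl icj R last a~f f<a ix₂ iy₂ x₂~y₂ x₂<a =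
    extend (Backward.TwoPairs.next-partner (inCtx-first (proj₁ (proj₁ bl))) ix₂ (inCtx-last icj last) iy₂
              a~f x₂~y₂ x₂<a f<a (backward-adjacent (adjacent-suc c)))
    where
    extend : (∃ λ c' → c ~ c' × In i c × In j c' × Backward.Adjacent c' f) → ⊥
    extend (c' , cc' , ic , ic' , c'-adjacent) =
      extend-left bl icj R refl (trans (adjacent⇒suc (forward-adjacent c'-adjacent)) last) ic ic' cc'

  -- Depending on the direction in which the last
  -- letter of the first block is matched, one of the two blocks extends.
  crossing-blocks : ∀ {i j a₁ ℓ₁ a₂ ℓ₂ b₁ m₁ b₂ m₂} →
                    Block G cs π i (a₁ , ℓ₁) → Block G cs π i (a₂ , ℓ₂) →
                    InCtx G cs j (b₁ , m₁) → InCtx G cs j (b₂ , m₂) →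
                    Rπ G cs π (a₁ , ℓ₁) (b₁ , m₁) → Rπ G cs π (a₂ , ℓ₂) (b₂ , m₂) →
                    a₁ < a₂ → a₁ + ℓ₁ < a₂ + ℓ₂ → ⊥
  crossing-blocks {i} {j} {a₂ = suc c} {b₁ = b₁} {b₂ = b₂} bl₁ bl₂ icj₁ icj₂ R₁ R₂ a₁<a₂@(s≤s _) end₁<end₂ =
    by-cases (ℕₚ.<-cmp E₁.lastᵤ b₁)
    where
    module E₁ = Ends (ends R₁)
    module E₂ = Ends (ends R₂)
    ie₁ : In i E₁.lastᵤ
    ie₁ = inCtx-last (proj₁ (proj₁ bl₁)) E₁.lastᵤ-is
    ie₂ : In i E₂.lastᵤ
    ie₂ = inCtx-last (proj₁ (proj₁ bl₂)) E₂.lastᵤ-is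
    ib₁ : In j b₁
    ib₁ = inCtx-first icj₁
    ib₂ : In j b₂
    ib₂ = inCtx-first icj₂
    ia₂ : In i (suc c)
    ia₂ = inCtx-first (proj₁ (proj₁ bl₂))
    if₂ : In j E₂.lastᵥ
    if₂ = inCtx-last icj₂ E₂.lastᵥ-is
    e₁<e₂ : E₁.lastᵤ < E₂.lastᵤ
    e₁<e₂ = ℕₚ.≤-pred (subst₂ _<_ (≡-sym E₁.lastᵤ-is) (≡-sym E₂.lastᵤ-is) end₁<end₂)

    by-cases : Tri (E₁.lastᵤ < b₁) (E₁.lastᵤ ≡ b₁) (b₁ < E₁.lastᵤ) → ⊥
    by-cases (tri< e₁<b₁ _ _) =
      forward-extension bl₁ icj₁ R₁ E₁.lastᵤ-is E₁.last~first e₁<b₁ ie₂ ib₂ E₂.last~first e₁<e₂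
    by-cases (tri≈ _ e₁≡b₁ _) = separated E₁.last~first ie₁ (subst (In i) e₁≡b₁ ie₁)
    by-cases (tri> _ _ b₁<e₁) =
      backward-extension bl₂ icj₂ R₂ E₂.lastᵥ-is E₂.first~last
        (Backward.separation E₁.last~first E₂.first~last ie₁ ia₂ ib₁ if₂ b₁<e₁)
        (inCtx-first (proj₁ (proj₁ bl₁))) (inCtx-last icj₁ E₁.lastᵥ-is) E₁.first~last a₁<a₂

infix-cases : ∀ (G : Graph) a₁ ℓ₁ a₂ ℓ₂ →
              _⊑_ G (a₁ , ℓ₁) (a₂ , ℓ₂) ⊎ _⊑_ G (a₂ , ℓ₂) (a₁ , ℓ₁) ⊎
              (a₁ < a₂ × a₁ + ℓ₁ < a₂ + ℓ₂) ⊎ (a₂ < a₁ × a₂ + ℓ₂ < a₁ + ℓ₁)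
infix-cases G a₁ ℓ₁ a₂ ℓ₂ with ℕₚ.<-cmp a₁ a₂ | a₁ + ℓ₁ ℕₚ.≤? a₂ + ℓ₂ | a₂ + ℓ₂ ℕₚ.≤? a₁ + ℓ₁
... | tri< a₁<a₂ _ _ | _          | yes e₂≤e₁ = inj₂ (inj₁ (ℕₚ.<⇒≤ a₁<a₂ , e₂≤e₁))
... | tri< a₁<a₂ _ _ | _          | no e₂≰e₁  = inj₂ (inj₂ (inj₁ (a₁<a₂ , ℕₚ.≰⇒> e₂≰e₁)))
... | tri≈ _ refl _  | yes e₁≤e₂  | _         = inj₁ (ℕₚ.≤-refl , e₁≤e₂)
... | tri≈ _ refl _  | no e₁≰e₂   | _         = inj₂ (inj₁ (ℕₚ.≤-refl , ℕₚ.<⇒≤ (ℕₚ.≰⇒> e₁≰e₂)))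
... | tri> _ _ a₂<a₁ | yes e₁≤e₂  | _         = inj₁ (ℕₚ.<⇒≤ a₂<a₁ , e₁≤e₂)
... | tri> _ _ a₂<a₁ | no e₁≰e₂   | _         = inj₂ (inj₂ (inj₂ (a₂<a₁ , ℕₚ.≰⇒> e₁≰e₂)))

-- Of two such blocks one contains the other, and then they coincide by
-- maximality, or they cross, which crossing-blocks rules out.
lemma17 : (G : Graph) (w : Word G) → _≅_ G w [] →
    (cs : List (Word G)) → Decomp G w cs → All (Irreducible G) cs →
    (π : Reduction G w) → (i j : Fin (length cs)) →
    (B₁ B₂ B₁' B₂' : Infix G) →
    Block G cs π i B₁ → Block G cs π i B₂ →
    Block G cs π j B₁' → Block G cs π j B₂' →
    Rπ G cs π B₁ B₁' → Rπ G cs π B₂ B₂' →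
    B₁ ≡ B₂
lemma17 G w _ cs dc irr π i j (a₁ , ℓ₁) (a₂ , ℓ₂) _ _ bl₁ bl₂ bl₁' bl₂' R₁ R₂
  with infix-cases G a₁ ℓ₁ a₂ ℓ₂
... | inj₁ B₁⊑B₂                    = proj₂ bl₁ _ (proj₁ bl₂) B₁⊑B₂
... | inj₂ (inj₁ B₂⊑B₁)             = ≡-sym (proj₂ bl₂ _ (proj₁ bl₁) B₂⊑B₁)
... | inj₂ (inj₂ (inj₁ (a₁<a₂ , e₁<e₂))) =
  ⊥-elim (Blocks.crossing-blocks G dc irr π bl₁ bl₂ (proj₁ (proj₁ bl₁')) (proj₁ (proj₁ bl₂')) R₁ R₂ a₁<a₂ e₁<e₂)
... | inj₂ (inj₂ (inj₂ (a₂<a₁ , e₂<e₁))) =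
  ⊥-elim (Blocks.crossing-blocks G dc irr π bl₂ bl₁ (proj₁ (proj₁ bl₂')) (proj₁ (proj₁ bl₁')) R₂ R₁ a₂<a₁ e₂<e₁)
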